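{- Let $\alpha\in\mathcal{C}_n$, $i\in[n-1]$ and $z\in[n-i-\alpha_i]$. If $\alpha$ is $(i,z)$-insertable, then there exists a unique composition $\alpha''$ such that $\alpha''$ covers $\alpha$ and $\alpha''_i=\alpha_i+z$; namely $\alpha''$ is given by $\alpha''_i=\alpha_i+z$, $\alpha''_{\widehat J(i,z)}=\alpha_{\widehat J(i,z)}-z+1$, and $\alpha''_m=\alpha_m$ for $m\notin\{i,\widehat J(i,z)\}$.
   Context: $[n]=\{1,\dots,n\}$. A (weak) composition is a finite sequence of nonnegative integers $(\alpha_1,\dots,\alpha_m)$ with $\alpha_k=0$ for $k>m$; $|\alpha|=\sum\alpha_k$. $\mathcal{C}_n$ is the set of compositions $(\alpha_1,\dots,\alpha_{n-1})$ with $0\leqslant\alpha_i\leqslant n-i$. For a composition $\alpha$, a positive integer $i$ and $j\in\mathbb{N}$: $c_{i,j}(\alpha)=0$ if $j\leqslant i+1$; for $j>i+1$, $c_{i,j}(\alpha)=c_{i,j-1}(\alpha)+1$ if $\alpha_{j-1}<\alpha_i-c_{i,j-1}(\alpha)$ and $c_{i,j}(\alpha)=c_{i,j-1}(\alpha)$ otherwise. For compositions with $|\alpha|=|\alpha'|+1$, $\alpha$ covers $\alpha'$ if there are positive integers $i<j$ with: (a1) $\alpha'_i\leqslant\alpha_i-1$; (a2) $\alpha'_j=\alpha_j+\alpha_i-\alpha'_i-1$; (a3) $\alpha'_k=\alpha_k$ for $k\neq i,j$; (a4) $c_{i,j}(\alpha)=c_{i,j}(\alpha')=\alpha'_i-\alpha_j$.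 For $\alpha\in\mathcal{C}_n$, $i\in[n-1]$, $z\in[n-i-\alpha_i]$: $\alpha$ is $(i,z)$-insertable if there exists $\alpha''\in\mathcal{C}_n$ with $\alpha''_i=\alpha_i+z$ such that $\alpha''$ covers $\alpha$. With $\widehat\alpha$ given by $\widehat\alpha_i=\alpha_i+z$, $\widehat\alpha_m=\alpha_m$ ($m\neq i$), set $\widehat J(i,z)=\max\{j>i:c_{i,j}(\alpha)=c_{i,j}(\widehat\alpha)\}$. -}

module Defs where

open import Data.Nat using (ℕ; zero; suc; _+_; _∸_; _≤_; _<_; _≤ᵇ_; _<ᵇ_; _≡ᵇ_)
open import Data.Bool using (if_then_else_)
open import Data.Product using (Σ; _×_; ∃-syntax)
open import Relation.Binary.PropositionalEquality using (_≡_; _≢_)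

-- A (weak) composition, indexed from 1: seq k = α_k for k ≥ 1.
-- seq 0 is forced to be 0 (unused position), and α_k = 0 for k > len.
record Composition : Set where
  constructor mkComp
  field
    seq     : ℕ → ℕ
    len     : ℕ
    seq0    : seq 0 ≡ 0
    support : ∀ k → len < k → seq k ≡ 0
open Composition public

sumTo : (ℕ → ℕ) → ℕ → ℕ
sumTo f zero    = 0
sumTo f (suc m) = sumTo f m + f (suc m)

size : Composition → ℕ
size α = sumTo (seq α) (len α)

InC : ℕ → Composition → Set
InC n α = (∀ k → n ≤ k → seq α k ≡ 0) × (∀ i → 1 ≤ i → i < n → seq α i ≤ n ∸ i)

-- c_{i,j}(α); c_{i,j} = 0 for j ≤ i+1, otherwise the recursive step.
-- (α_i - c is natural subtraction; when c ≥ α_i the test α_{j-1} < α_i - c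
--  is false both in ℤ and with truncated subtraction.)
cc : (ℕ → ℕ) → ℕ → ℕ → ℕ
cc α i zero    = 0
cc α i (suc j) =
  if j ≤ᵇ i then 0
  else (if α j <ᵇ (α i ∸ cc α i j) then suc (cc α i j) else cc α i j)

Covers : Composition → Composition → Set
Covers α α' =
  size α ≡ suc (size α') ×
  ∃[ i ] ∃[ j ] (1 ≤ i × i < j ×
    seq α' i < seq α i ×
    seq α' j ≡ seq α j + (seq α i ∸ seq α' i ∸ 1) ×
    (∀ k → k ≢ i → k ≢ j → seq α' k ≡ seq α k) ×
    cc (seq α) i j ≡ cc (seq α') i j ×
    cc (seq α') i j + seq α j ≡ seq α' i)

Insertable : ℕ → Composition → ℕ → ℕ → Set
Insertable n α i z =
  Σ Composition λ α'' → InC n α'' × seq α'' i ≡ seq α i + z × Covers α'' α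

hat : Composition → ℕ → ℕ → ℕ → ℕ
hat α i z k = if k ≡ᵇ i then seq α i + z else seq α k

IsJhat : Composition → ℕ → ℕ → ℕ → Set
IsJhat α i z J =
  i < J × cc (seq α) i J ≡ cc (hat α i z) i J ×
  (∀ j → J < j → cc (seq α) i j ≢ cc (hat α i z) i j)

module Submission where

-- Let α̂ be α with α_i raised by z. Along j the counters satisfy
-- c_{i,j}(α) ≤ c_{i,j}(α̂) ≤ c_{i,j}(α) + z, and once they differ they differ
-- forever, so Ĵ is the last index where they agree. If α'' covers α with
-- α''_i = α_i + z, the raised entry i must be the first index of the cover; at
-- its second index j, (a4) and the fact that α'' agrees with α̂ on [i, j) give
-- c_{i,j}(α) = c_{i,j}(α̂), while one more step separates them. Hence j = Ĵ,
-- and (a2), (a3) then determine α'' completely.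

open import Defs
open import Data.Nat using (ℕ; zero; suc; _+_; _∸_; _≤_; _<_; _≮_; _≤′_; ≤′-refl; ≤′-step; _≤ᵇ_; _<ᵇ_; _≡ᵇ_; z≤n; s≤s; z<s)
open import Data.Nat.Properties
open import Data.Bool using (true; false; if_then_else_)
open import Data.Product using (Σ; _×_; ∃-syntax; _,_; proj₁; proj₂)
open import Data.Sum using (inj₁; inj₂)
open import Function using (_∘_)
open import Relation.Binary.Definitions using (tri<; tri≈; tri>)
open import Relation.Nullary using (yes; no; contradiction)
open import Relation.Nullary.Reflects using (ofʸ; ofⁿ)
open import Relation.Binary.PropositionalEquality using (_≡_; _≢_; refl; sym; trans; cong; cong₂; subst; module ≡-Reasoning)

step : ℕ → ℕ → ℕ → ℕ
step a A c = if a <ᵇ A ∸ c then suc c else c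

data StepCase (a A c : ℕ) : ℕ → Set where
  step-increments : a < A ∸ c → StepCase a A c (suc c)
  step-stays      : a ≮ A ∸ c → StepCase a A c c

stepCase : ∀ a A c → StepCase a A c (step a A c)
stepCase a A c with a <ᵇ A ∸ c | <ᵇ-reflects-< a (A ∸ c)
... | true  | ofʸ a<A∸c = step-increments a<A∸c
... | false | ofⁿ a≮A∸c = step-stays a≮A∸c

∸-shift-≡ : ∀ A c z → (A + z) ∸ (c + z) ≡ A ∸ c
∸-shift-≡ A c z = trans (cong₂ _∸_ (+-comm A z) (+-comm c z)) ([m+n]∸[m+o]≡n∸o z A c)

∸-shift-≤ : ∀ A c d z → d ≤ c + z → A ∸ c ≤ (A + z) ∸ d
∸-shift-≤ A c d z d≤c+z = subst (_≤ (A + z) ∸ d) (∸-shift-≡ A c z) (∸-monoʳ-≤ (A + z) d≤c+z)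

step-shift-bounds : ∀ a A z {c d} → c ≤ d → d ≤ c + z →
  step a A c ≤ step a (A + z) d × step a (A + z) d ≤ step a A c + z
step-shift-bounds a A z {c} {d} c≤d d≤c+z
  with step a A c | stepCase a A c | step a (A + z) d | stepCase a (A + z) d
... | _ | step-increments _ | _ | step-increments _ = s≤s c≤d , s≤s d≤c+z
... | _ | step-increments a<A∸c | _ | step-stays a≮ =
  contradiction (<-≤-trans a<A∸c (∸-shift-≤ A c d z d≤c+z)) a≮
... | _ | step-stays a≮A∸c | _ | step-increments a< = m≤n⇒m≤1+n c≤d , d<c+z
  where
  d<c+z : d < c + z
  d<c+z with m≤n⇒m<n∨m≡n d≤c+z
  ... | inj₁ d<c+z = d<c+z
  ... | inj₂ refl  = contradiction (subst (a <_) (∸-shift-≡ A c z) a<) a≮A∸c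
... | _ | step-stays _ | _ | step-stays _ = c≤d , d≤c+z

step-shift-≢ : ∀ a A z {c d} → c ≤ d → d ≤ c + z → c ≢ d → step a A c ≢ step a (A + z) d
step-shift-≢ a A z {c} {d} c≤d d≤c+z c≢d
  with step a A c | stepCase a A c | step a (A + z) d | stepCase a (A + z) d
... | _ | step-increments _ | _ | step-increments _ = c≢d ∘ suc-injective
... | _ | step-increments a<A∸c | _ | step-stays a≮ =
  contradiction (<-≤-trans a<A∸c (∸-shift-≤ A c d z d≤c+z)) a≮
... | _ | step-stays _ | _ | step-increments _ = <⇒≢ (s≤s c≤d)
... | _ | step-stays _ | _ | step-stays _ = c≢d

-- At the second index j of a cover, (a2) and (a4) make the counter of α stall
-- while that of α̂ increments.
step-split : ∀ b c z' {A} → c + b ≡ A → step (b + z') A c ≢ step (b + z') (A + suc z') c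
step-split b c z' refl
  with step (b + z') (c + b) c | stepCase (b + z') (c + b) c
     | step (b + z') (c + b + suc z') c | stepCase (b + z') (c + b + suc z') c
... | _ | step-increments b+z'<c+b∸c | _ | _ =
  contradiction (subst (b + z' <_) (m+n∸m≡n c b) b+z'<c+b∸c) (≤⇒≯ (m≤m+n b z'))
... | _ | step-stays _ | _ | step-stays b+z'≮ =
  contradiction (subst (b + z' <_) (sym c+b+sz'∸c≡b+sz') (+-monoʳ-< b ≤-refl)) b+z'≮
  where
  c+b+sz'∸c≡b+sz' : c + b + suc z' ∸ c ≡ b + suc z'
  c+b+sz'∸c≡b+sz' = trans (cong (_∸ c) (+-assoc c b (suc z'))) (m+n∸m≡n c (b + suc z'))
... | _ | step-stays _ | _ | step-increments _ = <⇒≢ (n<1+n _)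

cc-suc : ∀ f i j → i < j → cc f i (suc j) ≡ step (f j) (f i) (cc f i j)
cc-suc f i j i<j with j ≤ᵇ i | ≤ᵇ-reflects-≤ j i
... | true  | ofʸ j≤i = contradiction j≤i (<⇒≱ i<j)
... | false | ofⁿ _   = refl

cc-≤suc : ∀ f i j → j ≤ suc i → cc f i j ≡ 0
cc-≤suc f i zero    _         = refl
cc-≤suc f i (suc j) (s≤s j≤i) with j ≤ᵇ i | ≤ᵇ-reflects-≤ j i
... | true  | _        = refl
... | false | ofⁿ j≰i = contradiction j≤i j≰i

cc-cong : ∀ f g i j → f i ≡ g i → (∀ k → i < k → k < j → f k ≡ g k) → cc f i j ≡ cc g i j
cc-cong f g i zero    _      _   = refl
cc-cong f g i (suc j) fi≡gi f≡g with i <? j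
... | no i≮j = trans (cc-≤suc f i (suc j) j≤1+i) (sym (cc-≤suc g i (suc j) j≤1+i))
  where j≤1+i = s≤s (≮⇒≥ i≮j)
... | yes i<j = begin
  cc f i (suc j)               ≡⟨ cc-suc f i j i<j ⟩
  step (f j) (f i) (cc f i j)  ≡⟨ cong₂ (λ a c → step a (f i) c) (f≡g j i<j ≤-refl) ccf≡ccg ⟩
  step (g j) (f i) (cc g i j)  ≡⟨ cong (λ A → step (g j) A (cc g i j)) fi≡gi ⟩
  step (g j) (g i) (cc g i j)  ≡⟨ cc-suc g i j i<j ⟨
  cc g i (suc j)               ∎
  where
  open ≡-Reasoning
  ccf≡ccg : cc f i j ≡ cc g i j
  ccf≡ccg = cc-cong f g i j fi≡gi (λ k i<k k<j → f≡g k i<k (m≤n⇒m≤1+n k<j))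

module _ (α : Composition) (i z : ℕ) where

  hat-self : hat α i z i ≡ seq α i + z
  hat-self with i ≡ᵇ i | ≡⇒≡ᵇ i i refl
  ... | true | _ = refl

  hat-other : ∀ {k} → k ≢ i → hat α i z k ≡ seq α k
  hat-other {k} k≢i with k ≡ᵇ i | ≡ᵇ⇒≡ k i
  ... | true  | k≡i = contradiction (k≡i _) k≢i
  ... | false | _   = refl

  cc-hat-suc : ∀ {j} → i < j →
    cc (hat α i z) i (suc j) ≡ step (seq α j) (seq α i + z) (cc (hat α i z) i j)
  cc-hat-suc {j} i<j = begin
    cc (hat α i z) i (suc j)                                   ≡⟨ cc-suc (hat α i z) i j i<j ⟩
    step (hat α i z j) (hat α i z i) (cc (hat α i z) i j)      ≡⟨ cong₂ (λ a A → step a A (cc (hat α i z) i j)) (hat-other (>⇒≢ i<j)) hat-self ⟩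
    step (seq α j) (seq α i + z) (cc (hat α i z) i j)          ∎
    where open ≡-Reasoning

  cc-hat-bounds : ∀ j → cc (seq α) i j ≤ cc (hat α i z) i j × cc (hat α i z) i j ≤ cc (seq α) i j + z
  cc-hat-bounds zero = z≤n , z≤n
  cc-hat-bounds (suc j) with i <? j
  ... | no i≮j
    rewrite cc-≤suc (seq α) i (suc j) (s≤s (≮⇒≥ i≮j)) | cc-≤suc (hat α i z) i (suc j) (s≤s (≮⇒≥ i≮j)) =
    z≤n , z≤n
  ... | yes i<j rewrite cc-suc (seq α) i j i<j | cc-hat-suc i<j =
    step-shift-bounds (seq α j) (seq α i) z (proj₁ (cc-hat-bounds j)) (proj₂ (cc-hat-bounds j))

  cc-hat-≢-suc : ∀ {j} → i < j → cc (seq α) i j ≢ cc (hat α i z) i j →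
    cc (seq α) i (suc j) ≢ cc (hat α i z) i (suc j)
  cc-hat-≢-suc {j} i<j ccs≢ rewrite cc-suc (seq α) i j i<j | cc-hat-suc i<j =
    step-shift-≢ (seq α j) (seq α i) z (proj₁ (cc-hat-bounds j)) (proj₂ (cc-hat-bounds j)) ccs≢

  cc-hat-≢-mono : ∀ {j j′} → i < j → j ≤′ j′ → cc (seq α) i j ≢ cc (hat α i z) i j →
    cc (seq α) i j′ ≢ cc (hat α i z) i j′
  cc-hat-≢-mono i<j ≤′-refl           ccs≢ = ccs≢
  cc-hat-≢-mono i<j (≤′-step j≤′j′) ccs≢ =
    cc-hat-≢-suc (<-≤-trans i<j (≤′⇒≤ j≤′j′)) (cc-hat-≢-mono i<j j≤′j′ ccs≢)

  IsJhat-lastAgreement : ∀ {J} → i < J → cc (seq α) i J ≡ cc (hat α i z) i J →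
    cc (seq α) i (suc J) ≢ cc (hat α i z) i (suc J) → IsJhat α i z J
  IsJhat-lastAgreement i<J agree split =
    i<J , agree , λ j J<j → cc-hat-≢-mono (m<n⇒m<1+n i<J) (≤⇒≤′ J<j) split

  IsJhat-unique : ∀ {J J′} → IsJhat α i z J → IsJhat α i z J′ → J ≡ J′
  IsJhat-unique {J} {J′} (_ , agree , later-split) (_ , agree′ , later-split′) with <-cmp J J′
  ... | tri< J<J′ _ _ = contradiction agree′ (later-split J′ J<J′)
  ... | tri≈ _ J≡J′ _ = J≡J′
  ... | tri> _ _ J′<J = contradiction agree (later-split′ J J′<J)

cover-raises-only-source : ∀ {a b : ℕ → ℕ} {i j k d} → (∀ m → m ≢ i → m ≢ j → a m ≡ b m) →
  a j ≡ b j + d → a k < b k → k ≡ i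
cover-raises-only-source {a} {b} {i} {j} {k} {d} rest aj ak<bk with k ≟ i | k ≟ j
... | yes k≡i | _       = k≡i
... | no _    | yes refl = contradiction (≤-trans (m≤m+n (b k) d) (≤-reflexive (sym aj))) (<⇒≱ ak<bk)
... | no k≢i  | no k≢j   = contradiction (rest k k≢i k≢j) (<⇒≢ ak<bk)

raise-offset : ∀ {x y} z' → y ≡ x + suc z' → y ∸ x ∸ 1 ≡ z'
raise-offset {x} z' refl = cong (_∸ 1) (m+n∸m≡n x (suc z'))

cover-raising-IsJhat : ∀ (α β : Composition) {i j} z' → i < j → seq β i ≡ seq α i + suc z' →
  seq α j ≡ seq β j + z' → (∀ m → m ≢ i → m ≢ j → seq α m ≡ seq β m) →
  cc (seq β) i j ≡ cc (seq α) i j → cc (seq α) i j + seq β j ≡ seq α i →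
  IsJhat α i (suc z') j
cover-raising-IsJhat α β {i} {j} z' i<j βi αj rest ccβ≡ccα c+βj≡αi =
  IsJhat-lastAgreement α i z i<j agree split
  where
  z = suc z'
  c = cc (seq α) i j
  agree : c ≡ cc (hat α i z) i j
  agree = trans (sym ccβ≡ccα) (cc-cong (seq β) (hat α i z) i j (trans βi (sym (hat-self α i z)))
    (λ k i<k k<j → trans (sym (rest k (>⇒≢ i<k) (<⇒≢ k<j))) (sym (hat-other α i z (>⇒≢ i<k)))))
  split : cc (seq α) i (suc j) ≢ cc (hat α i z) i (suc j)
  split ccs≡ = step-split (seq β j) c z' c+βj≡αi (begin
    step (seq β j + z') (seq α i) c                  ≡⟨ cong (λ a → step a (seq α i) c) αj ⟨
    step (seq α j) (seq α i) c                       ≡⟨ cc-suc (seq α) i j i<j ⟨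
    cc (seq α) i (suc j)                             ≡⟨ ccs≡ ⟩
    cc (hat α i z) i (suc j)                         ≡⟨ cc-hat-suc α i z i<j ⟩
    step (seq α j) (seq α i + z) (cc (hat α i z) i j) ≡⟨ cong₂ (λ a c → step a (seq α i + z) c) αj (sym agree) ⟩
    step (seq β j + z') (seq α i + z) c              ∎)
    where open ≡-Reasoning

cover-raising : ∀ (α β : Composition) i z' → Covers β α → seq β i ≡ seq α i + suc z' →
  ∃[ J ] (IsJhat α i (suc z') J × seq β J + suc z' ≡ suc (seq α J) ×
          (∀ m → m ≢ i → m ≢ J → seq β m ≡ seq α m))
cover-raising α β i z' (_ , i′ , j , _ , i′<j , _ , a2 , rest , ccβ≡ccα , c+βj≡αi′) βi
  with cover-raises-only-source rest a2 (subst (seq α i <_) (sym βi) (m<m+n (seq α i) z<s))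
... | refl =
  j , cover-raising-IsJhat α β z' i′<j βi αj rest ccβ≡ccα c+βj≡αi′ , βj ,
  λ m m≢i m≢j → sym (rest m m≢i m≢j)
  where
  αj : seq α j ≡ seq β j + z'
  αj = trans a2 (cong (seq β j +_) (raise-offset z' βi))
  βj : seq β j + suc z' ≡ suc (seq α j)
  βj = trans (+-suc (seq β j) z') (cong suc (sym αj))

covers-raising-agree : ∀ (α β γ : Composition) i z' →
  Covers β α → seq β i ≡ seq α i + suc z' → Covers γ α → seq γ i ≡ seq α i + suc z' →
  ∀ k → seq β k ≡ seq γ k
covers-raising-agree α β γ i z' β⋗α βi γ⋗α γi k
  with cover-raising α β i z' β⋗α βi | cover-raising α γ i z' γ⋗α γi
... | J , isJ , βJ , βrest | _ , isJ′ , γJ , γrest with IsJhat-unique α i (suc z') isJ isJ′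
... | refl with k ≟ i | k ≟ J
...   | yes refl | _        = trans βi (sym γi)
...   | no _     | yes refl = +-cancelʳ-≡ (suc z') (seq β k) (seq γ k) (trans βJ (sym γJ))
...   | no k≢i   | no k≢J   = trans (βrest k k≢i k≢J) (sym (γrest k k≢i k≢J))

lemma3p11 : (n : ℕ) (α : Composition) → InC n α →
    (i : ℕ) → 1 ≤ i → i < n →
    (z : ℕ) → 1 ≤ z → z ≤ n ∸ i ∸ seq α i →
    Insertable n α i z →
    Σ Composition λ α'' →
      (Covers α'' α × seq α'' i ≡ seq α i + z) ×
      (∀ (β : Composition) → Covers β α → seq β i ≡ seq α i + z →
         ∀ k → seq β k ≡ seq α'' k) ×
      (∃[ J ] (IsJhat α i z J ×
         seq α'' J + z ≡ suc (seq α J) ×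
         (∀ m → m ≢ i → m ≢ J → seq α'' m ≡ seq α m)))
lemma3p11 n α _ i _ _ zero () _ _
lemma3p11 n α _ i _ _ (suc z') _ _ (α'' , _ , α''i , α''⋗α) =
  α'' , (α''⋗α , α''i) ,
  (λ β β⋗α βi → covers-raising-agree α β α'' i z' β⋗α βi α''⋗α α''i) ,
  cover-raising α α'' i z' α''⋗α α''i
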